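{- Let $\phi = C_1 \wedge \dots \wedge C_m$, with $m \geq 2$, be a 3-CNF formula, where $C_j = (\ell^j_1 \vee \ell^j_2 \vee \ell^j_3)$ for $1 \le j \le m$, and let $G$ be the graph associated with $\phi$ as described in the context. If $I$ is a satisfying truth assignment of $\phi$, then there exists a set $J \subseteq \{1,\dots,m\}$ such that $$S = T(I) \cup F(I) \cup \{c_j : j \in J\}$$ is an inclusion-wise minimal separator of $G$ of size at least $4$, where $T(I) = \{u^j_i : 1\le i\le 3,\ 1\le j\le m,\ I(\mathrm{var}(\ell^j_i)) = 1\}$ and $F(I) = \{w^j_i : 1\le i\le 3,\ 1\le j\le m,\ I(\mathrm{var}(\ell^j_i)) = 0\}$.
   Context: Here $\mathrm{var}(\ell)$ denotes the variable of the literal $\ell$, and $I(x)\in\{0,1\}$ is the value of variable $x$ under $I$. Graphs are simple. For a graph $G=(V,E)$ and vertices $a,b$, an $a$-$b$ separator is a set $S \subseteq V$, with $a,b \notin S$, such that $a$ and $b$ lie in different connected components of $G - S$. A set $S$ is a separator if it is an $a$-$b$ separator for some $a,b \in V$. An inclusion-wise minimal separator is a separator $S$ such that no proper subset of $S$ is a separator. Construction of $G$ from $\phi$. $G$ has two special vertices $a$ and $b$. For each clause $C_j$, $1\le j\le m$, create three induced paths $u^j_i v^j_i w^j_i$ ($i=1,2,3$) on three vertices each, and an extra vertex $c_j$. The vertex $a$ is adjacent to $u^j_1,u^j_2,u^j_3$, and $b$ is adjacent to $w^j_1,w^j_2,w^j_3$. For each $i \in \{1,2,3\}$, $c_j$ is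 made adjacent to $u^j_i$ if $\ell^j_i$ is a negative literal, and to $w^j_i$ if $\ell^j_i$ is a positive literal. The vertices $v^j_i$ are called middle vertices, and $V_1$ denotes the set of all vertices $u^j_i, v^j_i, w^j_i, c_j$. A pair $u^j_i, w^{j'}_{i'}$ (with $i,i' \in\{1,2,3\}$, $j,j' \in \{1,\dots,m\}$ not necessarily distinct) is called conflicting if $\ell^j_i$ and $\ell^{j'}_{i'}$ are literals of the same variable (i.e. $\ell^j_i=\ell^{j'}_{i'}$ or $\ell^j_i = \overline{\ell^{j'}_{i'}}$); pairs of two $u$-vertices or of two $w$-vertices are never conflicting. For every conflicting pair $u^j_i, w^{j'}_{i'}$ with $j \neq j'$, add a new vertex $y$ adjacent exactly to $u^j_i$ and $w^{j'}_{i'}$; let $V_2$ be the set of these vertices. Finally, to each vertex not in $V_1$ (that is, to $a$, $b$, and each vertex of $V_2$) and to each middle vertex $v^j_i$, attach a new pendant vertex (a new vertex of degree one adjacent only to it). There are no other vertices or edges. -}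

module Defs where

open import Data.Nat using (ℕ) renaming (_≟_ to _≟ℕ_)
open import Data.Fin using (Fin) renaming (_≟_ to _≟F_)
open import Data.Fin.Subset using (Subset; _∈_)
open import Data.Bool using (Bool; true; false; not; _∧_; T)
open import Data.Product using (Σ; ∃; _×_; _,_)
open import Data.Sum using (_⊎_)
open import Data.Empty using (⊥)
open import Relation.Nullary using (¬_)
open import Relation.Nullary.Decidable using (⌊_⌋)
open import Relation.Binary.PropositionalEquality using (_≡_; _≢_)

record Lit : Set where
  constructor lit
  field
    var : ℕ
    pos : Bool
open Lit public

-- A 3-CNF formula with m clauses: clause j is (φ j 0 ∨ φ j 1 ∨ φ j 2).
Formula : ℕ → Set
Formula m = Fin m → Fin 3 → Lit

Assignment : Set
Assignment = ℕ → Bool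

litValue : Assignment → Lit → Bool
litValue I (lit x true)  = I x
litValue I (lit x false) = not (I x)

Satisfies : ∀ {m} → Assignment → Formula m → Set
Satisfies I φ = ∀ j → ∃ λ i → litValue I (φ j i) ≡ true

-- u^j_i, w^{j'}_{i'} (j ≠ j') is a conflicting pair with an added vertex y
-- iff the two literals have the same variable and j ≠ j'.
conflictY : ∀ {m} → Formula m → Fin m → Fin 3 → Fin m → Fin 3 → Bool
conflictY φ j i j' i' =
  ⌊ var (φ j i) ≟ℕ var (φ j' i') ⌋ ∧ not ⌊ j ≟F j' ⌋

data Vertex {m : ℕ} (φ : Formula m) : Set where
  a b      : Vertex φ
  pa pb    : Vertex φ
  u v w    : Fin m → Fin 3 → Vertex φ
  pv       : Fin m → Fin 3 → Vertex φ
  c        : Fin m → Vertex φ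
  y        : (j : Fin m) (i : Fin 3) (j' : Fin m) (i' : Fin 3) →
             T (conflictY φ j i j' i') → Vertex φ
  py       : (j : Fin m) (i : Fin 3) (j' : Fin m) (i' : Fin 3) →
             T (conflictY φ j i j' i') → Vertex φ

data Edge {m : ℕ} {φ : Formula m} : Vertex φ → Vertex φ → Set where
  a-u   : ∀ j i → Edge a (u j i)
  b-w   : ∀ j i → Edge b (w j i)
  u-v   : ∀ j i → Edge (u j i) (v j i)
  v-w   : ∀ j i → Edge (v j i) (w j i)
  c-neg : ∀ j i → pos (φ j i) ≡ false → Edge (c j) (u j i)
  c-pos : ∀ j i → pos (φ j i) ≡ true  → Edge (c j) (w j i)
  y-u   : ∀ j i j' i' t → Edge (y j i j' i' t) (u j i)
  y-w   : ∀ j i j' i' t → Edge (y j i j' i' t) (w j' i')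
  pa-a  : Edge pa a
  pb-b  : Edge pb b
  pv-v  : ∀ j i → Edge (pv j i) (v j i)
  py-y  : ∀ j i j' i' t → Edge (py j i j' i' t) (y j i j' i' t)

Adj : ∀ {m} {φ : Formula m} → Vertex φ → Vertex φ → Set
Adj x z = Edge x z ⊎ Edge z x

VSet : ∀ {m} → Formula m → Set₁
VSet φ = Vertex φ → Set

_⊂_ : ∀ {m} {φ : Formula m} → VSet φ → VSet φ → Set
S' ⊂ S = (∀ x → S' x → S x) × ∃ λ x → S x × ¬ S' x

data Reach {m} {φ : Formula m} (S : VSet φ) : Vertex φ → Vertex φ → Set where
  here : ∀ {x} → ¬ S x → Reach S x x
  step : ∀ {x z t} → ¬ S x → Adj x z → Reach S z t → Reach S x t

IsSepFor : ∀ {m} {φ : Formula m} → VSet φ → Vertex φ → Vertex φ → Set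
IsSepFor S s t = ¬ S s × ¬ S t × ¬ Reach S s t

IsSeparator : ∀ {m} {φ : Formula m} → VSet φ → Set
IsSeparator S = ∃ λ s → ∃ λ t → IsSepFor S s t

IsMinimalSeparator : ∀ {m} {φ : Formula m} → VSet φ → Set₁
IsMinimalSeparator S = IsSeparator S × (∀ S' → S' ⊂ S → ¬ IsSeparator S')

AtLeast4 : ∀ {m} {φ : Formula m} → VSet φ → Set
AtLeast4 S = ∃ λ x₁ → ∃ λ x₂ → ∃ λ x₃ → ∃ λ x₄ →
  S x₁ × S x₂ × S x₃ × S x₄ ×
  x₁ ≢ x₂ × x₁ ≢ x₃ × x₁ ≢ x₄ × x₂ ≢ x₃ × x₂ ≢ x₄ × x₃ ≢ x₄

SepSet : ∀ {m} (φ : Formula m) → Assignment → Subset m → VSet φ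
SepSet φ I J (u j i) = I (var (φ j i)) ≡ true
SepSet φ I J (w j i) = I (var (φ j i)) ≡ false
SepSet φ I J (c j)   = j ∈ J
SepSet φ I J _       = ⊥

-- Call a vertex of G - S "on a's side" by the following rule: u-vertices are,
-- w-vertices are not, a middle vertex v^j_i (and a y-vertex attached to u^j_i)
-- is iff I falsifies var(ℓ^j_i), and c_j is iff clause j has a true negative
-- literal. Taking J to be the clauses with both a true negative and a true
-- positive literal, this side is constant along every edge of G - S, so S
-- separates a from b. Conversely every vertex of S has a neighbour in G - S
-- adjacent to a and one adjacent to b, and, because I satisfies φ, every
-- vertex of G - S is joined to a or to b; so removing any vertex from S
-- connects the whole graph, and S is a minimal separator. Its size is at
-- least 4 because it contains one of u^j_i, w^j_i for each of the 3m ≥ 6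
-- literal occurrences.
{-# OPTIONS --safe #-}
module Submission where

open import Defs
open import Data.Nat using (ℕ; _≤_; s≤s; z≤n) renaming (_≟_ to _≟ℕ_)
open import Data.Fin using (Fin)
open import Data.Fin.Patterns using (0F; 1F; 2F)
open import Data.Fin.Properties using (any?)
open import Data.Fin.Subset using (Subset; _∈_)
open import Data.Vec using (tabulate)
open import Data.Vec.Properties using (lookup∘tabulate; lookup⇒[]=; []=⇒lookup)
open import Data.Bool using (Bool; true; false; not; T; if_then_else_)
open import Data.Bool.Properties using (T-≡; T-∧; ¬-not) renaming (_≟_ to _≟𝔹_)
open import Data.Product using (∃; _×_; _,_; proj₁)
open import Data.Sum using (_⊎_; inj₁; inj₂; [_,_]′)
open import Data.Sum using () renaming (map to ⊎-map)
open import Function using (_∘_; id)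
open import Function.Bundles using (Equivalence)
open import Relation.Nullary using (¬_; does)
open import Relation.Nullary.Decidable using (⌊_⌋; _×-dec_; toWitness; fromWitness; dec-true; dec-false)
open import Relation.Unary using (Decidable)
open import Relation.Binary.PropositionalEquality using (_≡_; _≢_; refl; sym; trans; cong)

module _ {m : ℕ} {φ : Formula m} {S : VSet φ} where

  Reach-source : ∀ {x z} → Reach S x z → ¬ S x
  Reach-source (here x∉S)     = x∉S
  Reach-source (step x∉S _ _) = x∉S

  Reach-trans : ∀ {x y z} → Reach S x y → Reach S y z → Reach S x z
  Reach-trans (here _)       r′ = r′
  Reach-trans (step x∉S e r) r′ = step x∉S e (Reach-trans r r′)

  Reach-sym : ∀ {x z} → Reach S x z → Reach S z x
  Reach-sym (here x∉S)            = here x∉S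
  Reach-sym (step x∉S (inj₁ e) r) = Reach-trans (Reach-sym r) (step (Reach-source r) (inj₂ e) (here x∉S))
  Reach-sym (step x∉S (inj₂ e) r) = Reach-trans (Reach-sym r) (step (Reach-source r) (inj₁ e) (here x∉S))

  Reach-invariant : ∀ {A : Set} (f : Vertex φ → A) →
                    (∀ {x z} → ¬ S x → ¬ S z → Edge x z → f x ≡ f z) →
                    ∀ {x z} → Reach S x z → f x ≡ f z
  Reach-invariant f f-edge (here _)              = refl
  Reach-invariant f f-edge (step x∉S (inj₁ e) r) =
    trans (f-edge x∉S (Reach-source r) e) (Reach-invariant f f-edge r)
  Reach-invariant f f-edge (step x∉S (inj₂ e) r) =
    trans (sym (f-edge (Reach-source r) x∉S e)) (Reach-invariant f f-edge r)

  ¬IsSeparator-if-reaching : ∀ {r₁ r₂} → Reach S r₁ r₂ →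
                             (∀ x → ¬ S x → Reach S x r₁ ⊎ Reach S x r₂) →
                             ¬ IsSeparator S
  ¬IsSeparator-if-reaching r₁↝r₂ reaching (s , t , s∉S , t∉S , ¬s↝t) =
    ¬s↝t (Reach-trans (to-r₁ s s∉S) (Reach-sym (to-r₁ t t∉S)))
    where
      to-r₁ : ∀ x → ¬ S x → Reach S x _
      to-r₁ x x∉S = [ id , (λ x↝r₂ → Reach-trans x↝r₂ (Reach-sym r₁↝r₂)) ]′ (reaching x x∉S)

module _ {n : ℕ} {P : Fin n → Set} (P? : Decidable P) where

  fromDecidable : Subset n
  fromDecidable = tabulate (λ j → ⌊ P? j ⌋)

  ∈-fromDecidable⁺ : ∀ {j} → P j → j ∈ fromDecidable
  ∈-fromDecidable⁺ {j} p =
    lookup⇒[]= j _ (trans (lookup∘tabulate _ j) (Equivalence.to T-≡ (fromWitness p)))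

  ∈-fromDecidable⁻ : ∀ {j} → j ∈ fromDecidable → P j
  ∈-fromDecidable⁻ {j} j∈ =
    toWitness (Equivalence.from T-≡ (trans (sym (lookup∘tabulate _ j)) ([]=⇒lookup j∈)))

TrueLit : Assignment → Bool → Lit → Set
TrueLit I p l = pos l ≡ p × I (var l) ≡ p

trueLit? : ∀ I p → Decidable (TrueLit I p)
trueLit? I p l = (pos l ≟𝔹 p) ×-dec (I (var l) ≟𝔹 p)

litValue≡true⇒TrueLit : ∀ I l → litValue I l ≡ true → TrueLit I true l ⊎ TrueLit I false l
litValue≡true⇒TrueLit I (lit x true)  Ix≡true = inj₁ (refl , Ix≡true)
litValue≡true⇒TrueLit I (lit x false) _       with I x
... | false = inj₂ (refl , refl)

conflictY⇒var≡ : ∀ {m} (φ : Formula m) {j i j′ i′} →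
                 T (conflictY φ j i j′ i′) → var (φ j i) ≡ var (φ j′ i′)
conflictY⇒var≡ φ {j} {i} {j′} {i′} t =
  toWitness (proj₁ (Equivalence.to (T-∧ {⌊ var (φ j i) ≟ℕ var (φ j′ i′) ⌋}) t))

true≢false : true ≢ false
true≢false ()

module Construction {m : ℕ} (φ : Formula m) (I : Assignment) where

  HasTrueLit : Bool → Fin m → Set
  HasTrueLit p j = ∃ λ i → TrueLit I p (φ j i)

  hasTrueLit? : ∀ p → Decidable (HasTrueLit p)
  hasTrueLit? p j = any? (λ i → trueLit? I p (φ j i))

  Mixed : Fin m → Set
  Mixed j = HasTrueLit false j × HasTrueLit true j

  mixed? : Decidable Mixed
  mixed? j = hasTrueLit? false j ×-dec hasTrueLit? true j

  J : Subset m
  J = fromDecidable mixed?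

  S : VSet φ
  S = SepSet φ I J

  u∉S : ∀ {j i} → I (var (φ j i)) ≡ false → ¬ S (u j i)
  u∉S I≡false I≡true = true≢false (trans (sym I≡true) I≡false)

  w∉S : ∀ {j i} → I (var (φ j i)) ≡ true → ¬ S (w j i)
  w∉S I≡true I≡false = true≢false (trans (sym I≡true) I≡false)

  onSideOfA : Vertex φ → Bool
  onSideOfA a                = true
  onSideOfA pa               = true
  onSideOfA b                = false
  onSideOfA pb               = false
  onSideOfA (u j i)          = true
  onSideOfA (w j i)          = false
  onSideOfA (v j i)          = not (I (var (φ j i)))
  onSideOfA (pv j i)         = not (I (var (φ j i)))
  onSideOfA (y j i j′ i′ t)  = not (I (var (φ j i)))
  onSideOfA (py j i j′ i′ t) = not (I (var (φ j i)))
  onSideOfA (c j)            = does (hasTrueLit? false j)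

  onSideOfA-edge : ∀ {x z} → ¬ S x → ¬ S z → Edge x z → onSideOfA x ≡ onSideOfA z
  onSideOfA-edge _   _   (a-u j i)          = refl
  onSideOfA-edge _   _   (b-w j i)          = refl
  onSideOfA-edge u∉  _   (u-v j i)          rewrite ¬-not u∉ = refl
  onSideOfA-edge _   w∉  (v-w j i)          rewrite ¬-not w∉ = refl
  onSideOfA-edge _   u∉  (c-neg j i p)      = dec-true (hasTrueLit? false j) (i , p , ¬-not u∉)
  onSideOfA-edge c∉  w∉  (c-pos j i p)      =
    dec-false (hasTrueLit? false j) (λ neg → c∉ (∈-fromDecidable⁺ _ (neg , i , p , ¬-not w∉)))
  onSideOfA-edge _   u∉  (y-u j i j′ i′ t)  rewrite ¬-not u∉ = refl
  onSideOfA-edge _   w∉  (y-w j i j′ i′ t)  rewrite conflictY⇒var≡ φ t | ¬-not w∉ = refl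
  onSideOfA-edge _   _   pa-a               = refl
  onSideOfA-edge _   _   pb-b               = refl
  onSideOfA-edge _   _   (pv-v j i)         = refl
  onSideOfA-edge _   _   (py-y j i j′ i′ t) = refl

  S-separates-a-b : IsSepFor S a b
  S-separates-a-b = (λ ()) , (λ ()) , λ a↝b → true≢false (Reach-invariant onSideOfA onSideOfA-edge a↝b)

  module Reconnection {S′ : VSet φ} (S′⊆S : ∀ x → S′ x → S x) where

    ∉S′ : ∀ {x} → ¬ S x → ¬ S′ x
    ∉S′ x∉S = x∉S ∘ S′⊆S _

    u↝a : ∀ {j i} → ¬ S′ (u j i) → Reach S′ (u j i) a
    u↝a {j} {i} u∉ = step u∉ (inj₂ (a-u j i)) (here (∉S′ λ ()))

    w↝b : ∀ {j i} → ¬ S′ (w j i) → Reach S′ (w j i) b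
    w↝b {j} {i} w∉ = step w∉ (inj₂ (b-w j i)) (here (∉S′ λ ()))

    a↝b-via-v : ∀ j i → ¬ S′ (u j i) → ¬ S′ (w j i) → Reach S′ a b
    a↝b-via-v j i u∉ w∉ =
      Reach-trans (Reach-sym (u↝a u∉)) (step u∉ (inj₁ (u-v j i)) (step (∉S′ λ ()) (inj₁ (v-w j i)) (w↝b w∉)))

    a↝b-via : ∀ x → S x → ¬ S′ x → Reach S′ a b
    a↝b-via (u j i) I≡true  u∉ = a↝b-via-v j i u∉ (∉S′ (w∉S I≡true))
    a↝b-via (w j i) I≡false w∉ = a↝b-via-v j i (∉S′ (u∉S I≡false)) w∉
    a↝b-via (c j)   j∈J     c∉ with ∈-fromDecidable⁻ _ j∈J
    ... | (i , p , I≡false) , (i′ , p′ , I≡true) =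
      Reach-trans (Reach-sym (u↝a u∉))
        (step u∉ (inj₂ (c-neg j i p)) (step c∉ (inj₁ (c-pos j i′ p′)) (w↝b (∉S′ (w∉S I≡true)))))
      where
        u∉ : ¬ S′ (u j i)
        u∉ = ∉S′ (u∉S I≡false)

    ReachesTerminal : Vertex φ → Set
    ReachesTerminal x = Reach S′ x a ⊎ Reach S′ x b

    extend : ∀ {x z} → ¬ S′ x → Adj x z → ReachesTerminal z → ReachesTerminal x
    extend x∉ e = ⊎-map (step x∉ e) (step x∉ e)

    v-reachesTerminal : ∀ j i → ReachesTerminal (v j i)
    v-reachesTerminal j i with I (var (φ j i)) in I≡
    ... | true  = extend (∉S′ λ ()) (inj₁ (v-w j i)) (inj₂ (w↝b (∉S′ (w∉S I≡))))
    ... | false = extend (∉S′ λ ()) (inj₂ (u-v j i)) (inj₁ (u↝a (∉S′ (u∉S I≡))))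

    y-reachesTerminal : ∀ j i j′ i′ t → ReachesTerminal (y j i j′ i′ t)
    y-reachesTerminal j i j′ i′ t with I (var (φ j i)) in I≡
    ... | true  = extend (∉S′ λ ()) (inj₁ (y-w j i j′ i′ t))
                    (inj₂ (w↝b (∉S′ (w∉S (trans (cong I (sym (conflictY⇒var≡ φ t))) I≡)))))
    ... | false = extend (∉S′ λ ()) (inj₁ (y-u j i j′ i′ t)) (inj₁ (u↝a (∉S′ (u∉S I≡))))

    -- The only place where the satisfying assignment is needed: c_j has a
    -- neighbour outside S through any true literal of clause j.
    reachesTerminal : Satisfies I φ → ∀ x → ¬ S′ x → ReachesTerminal x
    reachesTerminal sat a                x∉ = inj₁ (here x∉)
    reachesTerminal sat b                x∉ = inj₂ (here x∉)
    reachesTerminal sat pa               x∉ = extend x∉ (inj₁ pa-a) (inj₁ (here (∉S′ λ ())))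
    reachesTerminal sat pb               x∉ = extend x∉ (inj₁ pb-b) (inj₂ (here (∉S′ λ ())))
    reachesTerminal sat (u j i)          x∉ = inj₁ (u↝a x∉)
    reachesTerminal sat (w j i)          x∉ = inj₂ (w↝b x∉)
    reachesTerminal sat (v j i)          x∉ = v-reachesTerminal j i
    reachesTerminal sat (pv j i)         x∉ = extend x∉ (inj₁ (pv-v j i)) (v-reachesTerminal j i)
    reachesTerminal sat (y j i j′ i′ t)  x∉ = y-reachesTerminal j i j′ i′ t
    reachesTerminal sat (py j i j′ i′ t) x∉ = extend x∉ (inj₁ (py-y j i j′ i′ t)) (y-reachesTerminal j i j′ i′ t)
    reachesTerminal sat (c j)            x∉ with sat j
    ... | i , true-lit with litValue≡true⇒TrueLit I (φ j i) true-lit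
    ...   | inj₁ (p , I≡true)  = extend x∉ (inj₁ (c-pos j i p)) (inj₂ (w↝b (∉S′ (w∉S I≡true))))
    ...   | inj₂ (p , I≡false) = extend x∉ (inj₁ (c-neg j i p)) (inj₁ (u↝a (∉S′ (u∉S I≡false))))

  S-minimal : Satisfies I φ → IsMinimalSeparator S
  S-minimal sat = (a , b , S-separates-a-b) , λ where
    S′ (S′⊆S , x , x∈S , x∉S′) →
      let open Reconnection S′⊆S
      in ¬IsSeparator-if-reaching (a↝b-via x x∈S x∉S′) (reachesTerminal sat)

  literalVertex : Fin m → Fin 3 → Vertex φ
  literalVertex j i = if I (var (φ j i)) then u j i else w j i

  literalVertex∈S : ∀ j i → S (literalVertex j i)
  literalVertex∈S j i with I (var (φ j i)) in I≡
  ... | true  = I≡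
  ... | false = I≡

  literalVertex-injective : ∀ {j i j′ i′} → literalVertex j i ≡ literalVertex j′ i′ → (j , i) ≡ (j′ , i′)
  literalVertex-injective {j} {i} {j′} {i′} eq with I (var (φ j i)) | I (var (φ j′ i′)) | eq
  ... | true  | true  | refl = refl
  ... | false | false | refl = refl

  literalVertex-≢ : ∀ {j i j′ i′} → (j , i) ≢ (j′ , i′) → literalVertex j i ≢ literalVertex j′ i′
  literalVertex-≢ ne = ne ∘ literalVertex-injective

  S-atLeast4 : ∀ {j₀ j₁} → j₀ ≢ j₁ → AtLeast4 S
  S-atLeast4 {j₀} {j₁} j₀≢j₁ =
    literalVertex j₀ 0F , literalVertex j₀ 1F , literalVertex j₀ 2F , literalVertex j₁ 0F ,
    literalVertex∈S j₀ 0F , literalVertex∈S j₀ 1F , literalVertex∈S j₀ 2F , literalVertex∈S j₁ 0F ,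
    literalVertex-≢ (λ ()) , literalVertex-≢ (λ ()) , literalVertex-≢ (j₀≢j₁ ∘ cong proj₁) ,
    literalVertex-≢ (λ ()) , literalVertex-≢ (λ ()) , literalVertex-≢ (λ ())

lemma2 : (m : ℕ) → 2 ≤ m → (φ : Formula m) → (I : Assignment) →
           Satisfies I φ →
           ∃ λ (J : Subset m) →
             IsMinimalSeparator (SepSet φ I J) × AtLeast4 (SepSet φ I J)
lemma2 _ (s≤s (s≤s z≤n)) φ I sat = J , S-minimal sat , S-atLeast4 {0F} {1F} (λ ())
  where open Construction φ I
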